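{- Let $R$ be a commutative ring with identity such that for each maximal ideal $\mathcal{M}$, $\mathcal{M}^i\neq\mathcal{M}^{i+1}$ for all $i\ge 0$ and $\bigcap_{i\geq0}\mathcal{M}^i=(0)$. Let $\mathcal{F}$ be a finite set of maximal ideals and $\mathit{M}(\mathcal{F})$ the monoid generated by $\mathcal{F}$. For every $\mathcal{I}\in\mathit{M}(\mathcal{F})$ let $a_{\mathcal{I}}\in\mathcal{S}_{\mathcal{I}}$. If $\mathcal{I}_1,\dots,\mathcal{I}_r\in\mathit{M}(\mathcal{F})$ are pairwise comaximal, then $$\prod_{i=1}^r a_{\mathcal{I}_i}\in\mathcal{S}_{\prod_{i=1}^r\mathcal{I}_i}.$$
   Context: $\mathit{M}(\mathcal{F})$ is the set of finite products of ideals in $\mathcal{F}$ ($R$ being the empty product), $\mathit{M}(\mathcal{F})^*=\mathit{M}(\mathcal{F})\setminus\{R\}$, and for $\mathcal{I}\in\mathit{M}(\mathcal{F})$, $\mathcal{S}_{\mathcal{I}}=\mathcal{I}\setminus\bigcup_{\mathcal{J}\in\mathit{M}(\mathcal{F})^*}\mathcal{I}\mathcal{J}$ (which is nonempty under the stated hypotheses). -}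

module Defs where

open import Level using (Level; _⊔_; Lift)
open import Algebra.Bundles using (CommutativeRing)
open import Data.Nat using (ℕ; zero; suc)
open import Data.Fin using (Fin; zero; suc)
open import Data.List using (List; []; _∷_)
open import Data.Product using (Σ; ∃; _×_; _,_)
open import Data.Unit.Polymorphic using (⊤)
open import Relation.Nullary using (¬_)
open import Relation.Unary using (Pred; _∈_; _⊆_; _≐_)

module RingDefs {c ℓ : Level} (R : CommutativeRing c ℓ) where
  open CommutativeRing R public using (Carrier; _≈_; _+_; _*_; 0#; 1#)

  -- Subsets of R live at this fixed level (closed under ideal products).
  Subset : Set _
  Subset = Pred Carrier (c ⊔ ℓ)

  Whole : Subset
  Whole _ = ⊤

  record IsIdeal (I : Subset) : Set (c ⊔ ℓ) where
    field
      resp   : ∀ {x y} → x ≈ y → I x → I y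
      zero∈  : I 0#
      +-closed : ∀ {x y} → I x → I y → I (x + y)
      *-closed : ∀ r {x} → I x → I (r * x)

  record IsMaximal (M : Subset) : Set (Level.suc (c ⊔ ℓ)) where
    field
      ideal    : IsIdeal M
      proper   : ¬ (1# ∈ M)
      maximal  : ∀ (J : Subset) → IsIdeal J → M ⊆ J → ¬ (1# ∈ J) → J ⊆ M

  data _·_ (I J : Subset) : Subset where
    mul  : ∀ {a b} → I a → J b → (I · J) (a * b)
    zro  : (I · J) 0#
    add  : ∀ {x y} → (I · J) x → (I · J) y → (I · J) (x + y)
    resp : ∀ {x y} → x ≈ y → (I · J) x → (I · J) y

  infixl 7 _·_

  _^_ : Subset → ℕ → Subset
  M ^ zero  = Whole
  M ^ suc i = (M ^ i) · M

  _⊕_ : Subset → Subset → Subset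
  (I ⊕ J) x = Σ Carrier λ a → Σ Carrier λ b → I a × J b × x ≈ a + b

  Comaximal : Subset → Subset → Set (c ⊔ ℓ)
  Comaximal I J = (I ⊕ J) ≐ Whole

  ∏ᴵ : ∀ {r} → (Fin r → Subset) → Subset
  ∏ᴵ {zero}  f = Whole
  ∏ᴵ {suc r} f = f zero · ∏ᴵ (λ i → f (suc i))

  ∏ : ∀ {r} → (Fin r → Carrier) → Carrier
  ∏ {zero}  f = 1#
  ∏ {suc r} f = f zero * ∏ (λ i → f (suc i))

  -- F : a finite family of (maximal) ideals indexed by Fin k.
  -- Elements of the monoid M(F) are the ideals ⟦ w ⟧ F for words w over Fin k.
  ⟦_⟧ : ∀ {k} → List (Fin k) → (Fin k → Subset) → Subset
  ⟦ [] ⟧    F = Whole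
  ⟦ j ∷ w ⟧ F = F j · ⟦ w ⟧ F

  -- S_I = I \ ⋃_{J ∈ M(F), J ≠ R} IJ
  S : ∀ {k} → (Fin k → Subset) → Subset → Subset
  S F I x = I x × (∀ w → ¬ (⟦ w ⟧ F ≐ Whole) → ¬ ((I · ⟦ w ⟧ F) x))

{-# OPTIONS --safe #-}
module Submission where

open import Defs
open import Level using (Level)
open import Algebra.Bundles using (CommutativeRing)
import Algebra.Properties.CommutativeSemigroup as CommutativeSemigroupProperties
open import Data.Nat using (ℕ; zero; suc)
open import Data.Fin using (Fin; zero; suc)
open import Data.Fin.Properties using (suc-injective)
open import Data.List using (List; []; _∷_)
open import Data.Product using (_×_; _,_; proj₁; proj₂; Σ)
open import Data.Empty using (⊥)
open import Data.Unit.Polymorphic using (tt)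
open import Relation.Nullary using (¬_)
open import Relation.Unary using (_∈_; _∉_; _≐_; _⊆_)
open import Relation.Binary.PropositionalEquality using (_≢_)
import Relation.Binary.Reasoning.Setoid as SetoidReasoning

-- Let M ∈ F and a ∈ S_I, b ∈ S_J with I + J = R. Since M is maximal, it cannot
-- contain both I and J; say I ⊄ M, so I + M = R. Then a ∉ M (otherwise
-- a ∈ I·M), hence aR + M = R, and ab ∈ J·M would force b ∈ J·M. Every proper
-- K ∈ M(F) lies in some M ∈ F, so ab ∉ IJ·K and ab ∈ S_{IJ}; induction on r,
-- using that I₁ is comaximal with I₂ ⋯ I_r, finishes the proof.

module IdealTheory {c ℓ : Level} (R : CommutativeRing c ℓ) where
  open RingDefs R
  open CommutativeRing R using (setoid; refl; sym; trans; +-cong; *-cong; *-comm;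
    *-assoc; distribˡ; +-identityˡ; +-identityʳ; *-identityʳ; zeroʳ; +-assoc;
    +-commutativeSemigroup)
  open CommutativeSemigroupProperties +-commutativeSemigroup using (interchange)
  open SetoidReasoning setoid

  Whole-isIdeal : IsIdeal Whole
  Whole-isIdeal = record
    { resp = λ _ _ → tt ; zero∈ = tt ; +-closed = λ _ _ → tt ; *-closed = λ _ _ → tt }

  ·-isIdeal : ∀ {I J} → IsIdeal I → IsIdeal (I · J)
  ·-isIdeal {I} {J} I-ideal = record
    { resp = resp ; zero∈ = zro ; +-closed = add ; *-closed = *-closed }
    where
    *-closed : ∀ r {x} → (I · J) x → (I · J) (r * x)
    *-closed r (mul {a} {b} a∈I b∈J) =
      resp (*-assoc r a b) (mul (IsIdeal.*-closed I-ideal r a∈I) b∈J)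
    *-closed r zro = resp (sym (zeroʳ r)) zro
    *-closed r (add {x} {y} x∈ y∈) =
      resp (sym (distribˡ r x y)) (add (*-closed r x∈) (*-closed r y∈))
    *-closed r (resp x≈y x∈) = resp (*-cong refl x≈y) (*-closed r x∈)

  ⊕-isIdeal : ∀ {A B} → IsIdeal A → IsIdeal B → IsIdeal (A ⊕ B)
  ⊕-isIdeal A-ideal B-ideal = record
    { resp = λ { x≈y (a , b , a∈ , b∈ , x≈) → a , b , a∈ , b∈ , trans (sym x≈y) x≈ }
    ; zero∈ = 0# , 0# , A.zero∈ , B.zero∈ , sym (+-identityˡ 0#)
    ; +-closed = λ { (a , b , a∈ , b∈ , x≈) (a′ , b′ , a′∈ , b′∈ , y≈) →
        a + a′ , b + b′ , A.+-closed a∈ a′∈ , B.+-closed b∈ b′∈ ,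
        trans (+-cong x≈ y≈) (interchange a b a′ b′) }
    ; *-closed = λ { r (a , b , a∈ , b∈ , x≈) →
        r * a , r * b , A.*-closed r a∈ , B.*-closed r b∈ ,
        trans (*-cong refl x≈) (distribˡ r a b) }
    }
    where
    module A = IsIdeal A-ideal
    module B = IsIdeal B-ideal

  ⟨_⟩ : Carrier → Subset
  ⟨ y ⟩ x = Σ Carrier λ t → x ≈ y * t

  ⟨⟩-isIdeal : ∀ y → IsIdeal ⟨ y ⟩
  ⟨⟩-isIdeal y = record
    { resp = λ { x≈x′ (t , x≈) → t , trans (sym x≈x′) x≈ }
    ; zero∈ = 0# , sym (zeroʳ y)
    ; +-closed = λ { (s , x≈) (t , x′≈) →
        s + t , trans (+-cong x≈ x′≈) (sym (distribˡ y s t)) }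
    ; *-closed = λ { r {x} (t , x≈) → r * t , (begin
        r * x        ≈⟨ *-cong refl x≈ ⟩
        r * (y * t)  ≈⟨ sym (*-assoc r y t) ⟩
        r * y * t    ≈⟨ *-cong (*-comm r y) refl ⟩
        y * r * t    ≈⟨ *-assoc y r t ⟩
        y * (r * t)  ∎) }
    }

  ·-mono : ∀ {I I′ J J′} → I ⊆ I′ → J ⊆ J′ → (I · J) ⊆ (I′ · J′)
  ·-mono I⊆ J⊆ (mul a∈ b∈) = mul (I⊆ a∈) (J⊆ b∈)
  ·-mono I⊆ J⊆ zro = zro
  ·-mono I⊆ J⊆ (add x∈ y∈) = add (·-mono I⊆ J⊆ x∈) (·-mono I⊆ J⊆ y∈)
  ·-mono I⊆ J⊆ (resp x≈y x∈) = resp x≈y (·-mono I⊆ J⊆ x∈)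

  ·-⊆ˡ : ∀ {I J} → IsIdeal I → (I · J) ⊆ I
  ·-⊆ˡ I-ideal (mul {a} {b} a∈ _) = IsIdeal.resp I-ideal (*-comm b a) (IsIdeal.*-closed I-ideal b a∈)
  ·-⊆ˡ I-ideal zro = IsIdeal.zero∈ I-ideal
  ·-⊆ˡ I-ideal (add x∈ y∈) = IsIdeal.+-closed I-ideal (·-⊆ˡ I-ideal x∈) (·-⊆ˡ I-ideal y∈)
  ·-⊆ˡ I-ideal (resp x≈y x∈) = IsIdeal.resp I-ideal x≈y (·-⊆ˡ I-ideal x∈)

  ·-⊆ʳ : ∀ {I J} → IsIdeal J → (I · J) ⊆ J
  ·-⊆ʳ J-ideal (mul {a} _ b∈) = IsIdeal.*-closed J-ideal a b∈
  ·-⊆ʳ J-ideal zro = IsIdeal.zero∈ J-ideal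
  ·-⊆ʳ J-ideal (add x∈ y∈) = IsIdeal.+-closed J-ideal (·-⊆ʳ J-ideal x∈) (·-⊆ʳ J-ideal y∈)
  ·-⊆ʳ J-ideal (resp x≈y x∈) = IsIdeal.resp J-ideal x≈y (·-⊆ʳ J-ideal x∈)

  ⊆-·-Whole : ∀ {I} → I ⊆ (I · Whole)
  ⊆-·-Whole {x = x} x∈ = resp (*-identityʳ x) (mul x∈ tt)

  1∈-·⇒≐Whole : ∀ {J} → IsIdeal J → (Whole · J) 1# → J ≐ Whole
  1∈-·⇒≐Whole J-ideal 1∈ =
    (λ _ → tt) ,
    λ {x} _ → IsIdeal.resp J-ideal (*-identityʳ x) (IsIdeal.*-closed J-ideal x (·-⊆ʳ J-ideal 1∈))

  ∏ᴵ-isIdeal : ∀ {r} (f : Fin r → Subset) → (∀ i → IsIdeal (f i)) → IsIdeal (∏ᴵ f)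
  ∏ᴵ-isIdeal {zero}  f _       = Whole-isIdeal
  ∏ᴵ-isIdeal {suc r} f f-ideal = ·-isIdeal (f-ideal zero)

  *-split : ∀ {u m} x → 1# ≈ u + m → x ≈ x * u + x * m
  *-split {u} {m} x 1≈ = begin
    x            ≈⟨ *-identityʳ x ⟨
    x * 1#       ≈⟨ *-cong refl 1≈ ⟩
    x * (u + m)  ≈⟨ distribˡ x u m ⟩
    x * u + x * m ∎

  ⊈-maximal⇒¬¬1∈⊕ : ∀ {M A} → IsMaximal M → IsIdeal A → ¬ (A ⊆ M) → ¬ ¬ ((A ⊕ M) 1#)
  ⊈-maximal⇒¬¬1∈⊕ {M} {A} M-maximal A-ideal A⊈M 1∉ = A⊈M λ {x} x∈A →
    IsMaximal.maximal M-maximal (A ⊕ M) (⊕-isIdeal A-ideal M-ideal)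
      (λ {m} m∈ → 0# , m , IsIdeal.zero∈ A-ideal , m∈ , sym (+-identityˡ m))
      1∉
      (x , 0# , x∈A , IsIdeal.zero∈ M-ideal , sym (+-identityʳ x))
    where M-ideal = IsMaximal.ideal M-maximal

  -- The witness comes from 1 = u₁ + v₁·1 = u₁ + v₁(u₂ + v₂).
  1∈⊕-∏ᴵ : ∀ {A r} → IsIdeal A → (f : Fin r → Subset) →
           (∀ i → (A ⊕ f i) 1#) → (A ⊕ ∏ᴵ f) 1#
  1∈⊕-∏ᴵ {r = zero} A-ideal f _ = 0# , 1# , IsIdeal.zero∈ A-ideal , tt , sym (+-identityˡ 1#)
  1∈⊕-∏ᴵ {r = suc r} A-ideal f 1∈
    with 1∈ zero | 1∈⊕-∏ᴵ A-ideal (λ i → f (suc i)) (λ i → 1∈ (suc i))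
  ... | u₁ , v₁ , u₁∈ , v₁∈ , 1≈₁ | u₂ , v₂ , u₂∈ , v₂∈ , 1≈₂ =
    u₁ + v₁ * u₂ , v₁ * v₂ ,
    IsIdeal.+-closed A-ideal u₁∈ (IsIdeal.*-closed A-ideal v₁ u₂∈) ,
    mul v₁∈ v₂∈ ,
    (begin
      1#                        ≈⟨ 1≈₁ ⟩
      u₁ + v₁                   ≈⟨ +-cong refl (*-split v₁ 1≈₂) ⟩
      u₁ + (v₁ * u₂ + v₁ * v₂)  ≈⟨ +-assoc u₁ _ _ ⟨
      u₁ + v₁ * u₂ + v₁ * v₂    ∎)

  module _ {k : ℕ} (F : Fin k → Subset) (F-maximal : ∀ j → IsMaximal (F j)) where

    ⟦⟧-isIdeal : ∀ w → IsIdeal (⟦ w ⟧ F)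
    ⟦⟧-isIdeal []      = Whole-isIdeal
    ⟦⟧-isIdeal (j ∷ w) = ·-isIdeal (IsMaximal.ideal (F-maximal j))

    ⟦[_]⟧-proper : ∀ j → ¬ (⟦ j ∷ [] ⟧ F ≐ Whole)
    ⟦[ j ]⟧-proper (_ , ⊇) =
      IsMaximal.proper (F-maximal j) (·-⊆ˡ (IsMaximal.ideal (F-maximal j)) (⊇ {1#} tt))

    ∈-·-F⇒∉S : ∀ {X x} j → (X · F j) x → x ∉ S F X
    ∈-·-F⇒∉S j x∈ (_ , x∉) = x∉ (j ∷ []) ⟦[ j ]⟧-proper (·-mono (λ p → p) ⊆-·-Whole x∈)

    S-∉-maximal : ∀ {X y} j → IsIdeal X → ¬ (X ⊆ F j) → y ∈ S F X → y ∉ F j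
    S-∉-maximal {y = y} j X-ideal X⊈ y∈S y∈F =
      ⊈-maximal⇒¬¬1∈⊕ (F-maximal j) X-ideal X⊈ λ { (u , m , u∈ , m∈ , 1≈) →
        ∈-·-F⇒∉S j
          (resp (sym (*-split y 1≈))
            (add (resp (*-comm u y) (mul u∈ y∈F)) (mul (proj₁ y∈S) m∈)))
          y∈S }

    S-*-∉ : ∀ {Y y z} j → IsIdeal Y → z ∈ S F Y → y ∉ F j → z * y ∉ Y · F j
    S-*-∉ {Y} {y} {z} j Y-ideal z∈S y∉F zy∈ =
      ⊈-maximal⇒¬¬1∈⊕ (F-maximal j) (⟨⟩-isIdeal y)
        (λ ⟨y⟩⊆F → y∉F (⟨y⟩⊆F (1# , sym (*-identityʳ y))))
        λ { (p , m , (t , p≈) , m∈ , 1≈) →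
          ∈-·-F⇒∉S j
            (resp (sym (*-split z 1≈))
              (add (resp (zp≈ p≈) (IsIdeal.*-closed (·-isIdeal Y-ideal) t zy∈))
                   (mul (proj₁ z∈S) m∈)))
            z∈S }
      where
      zp≈ : ∀ {p t} → p ≈ y * t → t * (z * y) ≈ z * p
      zp≈ {p} {t} p≈ = begin
        t * (z * y)  ≈⟨ *-comm t (z * y) ⟩
        z * y * t    ≈⟨ *-assoc z y t ⟩
        z * (y * t)  ≈⟨ *-cong refl p≈ ⟨
        z * p        ∎

    S-*-S : ∀ {I J a b} → IsIdeal I → IsIdeal J → (I ⊕ J) 1# →
            a ∈ S F I → b ∈ S F J → a * b ∈ S F (I · J)
    S-*-S {I} {J} {a} {b} I-ideal J-ideal (u , v , u∈ , v∈ , 1≈) a∈S b∈S =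
      mul (proj₁ a∈S) (proj₁ b∈S) , ∉-·-word
      where
      ∉-·-word : ∀ w → ¬ (⟦ w ⟧ F ≐ Whole) → ¬ (((I · J) · ⟦ w ⟧ F) (a * b))
      ∉-·-word []      proper _ = proper ((λ _ → tt) , (λ _ → tt))
      ∉-·-word (j ∷ w) _      ab∈ =
        ¬¬I⊆F (λ I⊆F → ¬¬J⊆F (λ J⊆F → not-both-in-F (I⊆F u∈) (J⊆F v∈)))
        where
        F-ideal = IsMaximal.ideal (F-maximal j)

        not-both-in-F : u ∈ F j → v ∈ F j → ⊥
        not-both-in-F u∈F v∈F = IsMaximal.proper (F-maximal j)
          (IsIdeal.resp F-ideal (sym 1≈) (IsIdeal.+-closed F-ideal u∈F v∈F))

        ¬¬I⊆F : ¬ ¬ (I ⊆ F j)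
        ¬¬I⊆F I⊈ = S-*-∉ j J-ideal b∈S (S-∉-maximal j I-ideal I⊈ a∈S)
          (resp (*-comm a b) (·-mono (·-⊆ʳ J-ideal) (·-⊆ˡ F-ideal) ab∈))

        ¬¬J⊆F : ¬ ¬ (J ⊆ F j)
        ¬¬J⊆F J⊈ = S-*-∉ j I-ideal a∈S (S-∉-maximal j J-ideal J⊈ b∈S)
          (·-mono (·-⊆ˡ I-ideal) (·-⊆ˡ F-ideal) ab∈)

    1∈S-Whole : 1# ∈ S F Whole
    1∈S-Whole = tt , λ w proper 1∈ → proper (1∈-·⇒≐Whole (⟦⟧-isIdeal w) 1∈)

    ∏-∈-S-∏ᴵ : ∀ {r} (f : Fin r → Subset) (x : Fin r → Carrier) →
               (∀ i → IsIdeal (f i)) → (∀ i j → i ≢ j → (f i ⊕ f j) 1#) →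
               (∀ i → x i ∈ S F (f i)) → ∏ x ∈ S F (∏ᴵ f)
    ∏-∈-S-∏ᴵ {zero}  f x _ _ _ = 1∈S-Whole
    ∏-∈-S-∏ᴵ {suc r} f x f-ideal coprime x∈S =
      S-*-S (f-ideal zero) (∏ᴵ-isIdeal (λ i → f (suc i)) (λ i → f-ideal (suc i)))
        (1∈⊕-∏ᴵ (f-ideal zero) (λ i → f (suc i)) (λ i → coprime zero (suc i) λ ()))
        (x∈S zero)
        (∏-∈-S-∏ᴵ (λ i → f (suc i)) (λ i → x (suc i)) (λ i → f-ideal (suc i))
          (λ i j i≢j → coprime (suc i) (suc j) (λ eq → i≢j (suc-injective eq)))
          (λ i → x∈S (suc i)))

mainTheorem9 : ∀ {c ℓ} (R : CommutativeRing c ℓ) →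
    let open RingDefs R in
    (∀ (M : Subset) → IsMaximal M →
       (∀ (i : ℕ) → ¬ ((M ^ i) ≐ (M ^ suc i)))
       × (∀ x → (∀ (i : ℕ) → x ∈ (M ^ i)) → x ≈ 0#)) →
    (k : ℕ) (F : Fin k → Subset) → (∀ j → IsMaximal (F j)) →
    (a : List (Fin k) → Carrier) →
    (∀ w → a w ∈ S F (⟦ w ⟧ F)) →
    (∀ w w′ → ⟦ w ⟧ F ≐ ⟦ w′ ⟧ F → a w ≈ a w′) →
    (r : ℕ) (I : Fin r → List (Fin k)) →
    (∀ i j → i ≢ j → Comaximal (⟦ I i ⟧ F) (⟦ I j ⟧ F)) →
    ∏ (λ i → a (I i)) ∈ S F (∏ᴵ (λ i → ⟦ I i ⟧ F))
-- The hypotheses on powers of maximal ideals only make the sets S nonempty.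
mainTheorem9 R _ k F F-maximal a a∈S _ r I comaximal =
  ∏-∈-S-∏ᴵ F F-maximal (λ i → ⟦ I i ⟧ F) (λ i → a (I i))
    (λ i → ⟦⟧-isIdeal F F-maximal (I i))
    (λ i j i≢j → proj₂ (comaximal i j i≢j) tt)
    (λ i → a∈S (I i))
  where
  open RingDefs R
  open IdealTheory R
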